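{- Let $p,q$ be odd primes and $k>0$ an integer such that $p^{2^k}+1=2q$ and $2^{2^{k+1}}\equiv 1\pmod q$. Then $(p,q)=(3,5)$ and $k=1$. -}

module Defs where

module Submission where

-- Put M = 2^k and X = 2^M.  The hypothesis says that the
-- prime q divides 2^(2M) - 1 = X² - 1 = (X - 1)(X + 1), so q divides one of
-- the two factors and hence q ≤ X + 1.  Since p is an odd prime, p ≥ 3, and
-- therefore
--     3^M + 1 ≤ p^M + 1 = 2q ≤ 2·2^M + 2.
-- For M ≥ 3 the power 3^M already exceeds 2·2^M + 2, so M = 2^k ≤ 2 forces
-- k = 1.  Then p² + 1 = 2q ≤ 2·(4 + 1) = 10 gives p ≤ 3, so p = 3 and q = 5.

open import Defs
open import Data.Nat using (ℕ; zero; suc; _+_; _*_; _∸_; _^_; _<_; _≤_; z≤n; s≤s)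
open import Data.Nat.Properties
open import Data.Nat.Divisibility using (_∣_; ∣-refl; ∣⇒≤)
open import Data.Nat.Primality using (Prime; prime; euclidsLemma)
open import Data.Nat.Tactic.RingSolver using (solve-∀)
open import Data.Product using (_×_; _,_)
open import Data.Sum using (inj₁; inj₂)
open import Data.Empty using (⊥-elim)
open import Relation.Nullary using (¬_)
open import Relation.Binary.PropositionalEquality using (_≡_; refl; sym; cong; subst; module ≡-Reasoning)

odd-prime⇒≥3 : ∀ {p} → Prime p → ¬ (2 ∣ p) → 3 ≤ p
odd-prime⇒≥3 {0} (prime {{()}} _) _
odd-prime⇒≥3 {1} (prime {{()}} _) _
odd-prime⇒≥3 {2} _ 2∤2 = ⊥-elim (2∤2 ∣-refl)
odd-prime⇒≥3 {suc (suc (suc _))} _ _ = s≤s (s≤s (s≤s z≤n))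

square-pred : ∀ x → x * x ∸ 1 ≡ (x ∸ 1) * (x + 1)
square-pred zero = refl
square-pred (suc y) = identity y
  where
  identity : ∀ y → y + y * suc y ≡ y * (suc y + 1)
  identity = solve-∀

-- A prime dividing x² - 1 divides x - 1 or x + 1, so it is at most x + 1.
-- (For x ≥ 2 the factor x - 1 is non-zero, which makes the bound valid.)
prime∣square-pred⇒≤ : ∀ {q} x → Prime q → 2 ≤ x → q ∣ (x * x ∸ 1) → q ≤ x + 1
prime∣square-pred⇒≤ (suc zero) _ (s≤s ()) _
prime∣square-pred⇒≤ {q} x@(suc y@(suc _)) q-prime _ q∣x²-1
  with euclidsLemma (x ∸ 1) (x + 1) q-prime (subst (q ∣_) (square-pred x) q∣x²-1)
... | inj₁ q∣y   = ≤-trans (∣⇒≤ q∣y) (≤-trans (n≤1+n y) (m≤m+n x 1))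
... | inj₂ q∣x+1 = ∣⇒≤ q∣x+1

-- From M = 3 on (27 ≥ 18), 3^M dominates 2·2^M + 2: one step multiplies the
-- left side by 2 and the right side by 3.
exp-growth : ∀ M → 3 ≤ M → 2 * 2 ^ M + 2 ≤ 3 ^ M
exp-growth (suc zero) (s≤s ())
exp-growth (suc (suc zero)) (s≤s (s≤s ()))
exp-growth (suc (suc (suc zero))) _ = m≤m+n 18 9
exp-growth (suc M@(suc (suc (suc _)))) _ = begin
    2 * (2 * 2 ^ M) + 2  ≤⟨ m≤m+n _ (2 * 2 ^ M + 4) ⟩
    2 * (2 * 2 ^ M) + 2 + (2 * 2 ^ M + 4)  ≡⟨ regroup (2 ^ M) ⟩
    3 * (2 * 2 ^ M + 2)  ≤⟨ *-monoʳ-≤ 3 (exp-growth M (s≤s (s≤s (s≤s z≤n)))) ⟩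
    3 * 3 ^ M  ∎
  where
  open ≤-Reasoning
  regroup : ∀ a → 2 * (2 * a) + 2 + (2 * a + 4) ≡ 3 * (2 * a + 2)
  regroup = solve-∀

pow-two-pow-suc : ∀ a k → a ^ (2 ^ (k + 1)) ≡ a ^ (2 ^ k) * a ^ (2 ^ k)
pow-two-pow-suc a k = begin
  a ^ (2 ^ (k + 1))        ≡⟨ cong (a ^_) (^-distribˡ-+-* 2 k 1) ⟩
  a ^ (2 ^ k * 2)          ≡⟨ ^-*-assoc a (2 ^ k) 2 ⟨
  (a ^ (2 ^ k)) ^ 2        ≡⟨ cong (a ^ (2 ^ k) *_) (*-identityʳ (a ^ (2 ^ k))) ⟩
  a ^ (2 ^ k) * a ^ (2 ^ k) ∎
  where open ≡-Reasoning

size-bound : ∀ p q k → Prime q → p ^ (2 ^ k) + 1 ≡ 2 * q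
           → q ∣ (2 ^ (2 ^ (k + 1)) ∸ 1)
           → p ^ (2 ^ k) + 1 ≤ 2 * (2 ^ (2 ^ k) + 1)
size-bound p q k q-prime eq q∣ = subst (_≤ 2 * (2 ^ (2 ^ k) + 1)) (sym eq) (*-monoʳ-≤ 2 q≤X+1)
  where
  X = 2 ^ (2 ^ k)
  2≤X : 2 ≤ X
  2≤X = ^-monoʳ-≤ 2 (^-monoʳ-≤ 2 {0} {k} z≤n)
  q≤X+1 : q ≤ X + 1
  q≤X+1 = prime∣square-pred⇒≤ X q-prime 2≤X
            (subst (λ n → q ∣ (n ∸ 1)) (pow-two-pow-suc 2 k) q∣)

lemma2p6 : (p q k : ℕ) → Prime p → ¬ (2 ∣ p) → Prime q → ¬ (2 ∣ q) → 0 < k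
    → p ^ (2 ^ k) + 1 ≡ 2 * q
    → q ∣ (2 ^ (2 ^ (k + 1)) ∸ 1)
    → (p ≡ 3 × q ≡ 5) × k ≡ 1
-- k = 1: p² + 1 ≤ 10 forces p ≤ 3, so p = 3 and then 2q = 10.
lemma2p6 p q 1 p-prime 2∤p q-prime _ _ eq q∣ = (p≡3 , q≡5) , refl
  where
  p²+1≤10 : p ^ 2 + 1 ≤ 10
  p²+1≤10 = size-bound p q 1 q-prime eq q∣
  p≤3 : p ≤ 3
  p≤3 = ≮⇒≥ λ 3<p → <⇒≱ (m<m+n 10 {6} (s≤s z≤n))
          (≤-trans (^-monoˡ-≤ 2 3<p) (≤-trans (m≤m+n (p ^ 2) 1) p²+1≤10))
  p≡3 : p ≡ 3
  p≡3 = ≤-antisym p≤3 (odd-prime⇒≥3 p-prime 2∤p)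
  q≡5 : q ≡ 5
  q≡5 = *-cancelˡ-≡ q 5 2 (sym (subst (λ n → n ^ 2 + 1 ≡ 2 * q) p≡3 eq))
lemma2p6 p q k@(suc (suc k′)) p-prime 2∤p q-prime _ _ eq q∣ =
  ⊥-elim (<⇒≱ (≤-<-trans (exp-growth M 3≤M) (m<m+n (3 ^ M) (s≤s z≤n))) (begin
    3 ^ M + 1          ≤⟨ +-monoˡ-≤ 1 (^-monoˡ-≤ M (odd-prime⇒≥3 p-prime 2∤p)) ⟩
    p ^ M + 1          ≤⟨ size-bound p q k q-prime eq q∣ ⟩
    2 * (2 ^ M + 1)    ≡⟨ *-distribˡ-+ 2 (2 ^ M) 1 ⟩
    2 * 2 ^ M + 2      ∎))
  where
  open ≤-Reasoning
  M = 2 ^ k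
  3≤M : 3 ≤ M
  3≤M = ≤-trans (n≤1+n 3) (*-monoʳ-≤ 2 (^-monoʳ-≤ 2 {1} {suc k′} (s≤s z≤n)))
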